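{- Let $G=(X,Y,E)$ be a bipartite graph with positive integer edge weights $w$ and largest edge weight $N$, let $h\in[1,N]$ be an integer, let $G_h$ be the graph formed by the edges $uv$ of $G$ with $w(u,v)\in[N-h+1,N]$, each with weight $w(u,v)-(N-h)$, and let $C_h$ be a minimum weight cover of $G_h$ (with $C_h(u)=0$ for nodes $u$ of $G$ not in $G_h$). Then there exists a minimum weight cover $C$ of $G$ such that $C(u)\ge C_h(u)$ for every node $u$ of $G$.
   Context: Set $w(u,v)=0$ for non-adjacent $u,v$. A cover of a bipartite graph with sides $X,Y$ is a function $C:X\cup Y\to\{0,1,2,\ldots\}$ with $C(x)+C(y)\ge w(x,y)$ for all $x\in X,y\in Y$; its weight is $\sum_z C(z)$; a minimum weight cover is one of minimum weight. -}

module Defs where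

open import Data.Nat using (ℕ; _+_; _≤_; _<_; _∸_)
open import Data.Fin using (Fin)
open import Data.List using (map; allFin)
open import Data.Nat.ListAction using (sum)
open import Relation.Nullary using (¬_)
open import Data.Product using (_×_; ∃)
open import Relation.Binary.PropositionalEquality using (_≡_)

-- A weighted bipartite graph with sides X = Fin m, Y = Fin n is given by
-- w : Fin m → Fin n → ℕ, where w x y = 0 iff x,y are non-adjacent
-- (edge weights are positive integers).
Weight : ℕ → ℕ → Set
Weight m n = Fin m → Fin n → ℕ

record Labeling (m n : ℕ) : Set where
  constructor ⟨_,_⟩
  field
    onX : Fin m → ℕ
    onY : Fin n → ℕ
open Labeling public

IsCover : ∀ {m n} → Weight m n → Labeling m n → Set
IsCover w C = ∀ x y → w x y ≤ onX C x + onY C y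

weight : ∀ {m n} → Labeling m n → ℕ
weight {m} {n} C = sum (map (onX C) (allFin m)) + sum (map (onY C) (allFin n))

IsMinCover : ∀ {m n} → Weight m n → Labeling m n → Set
IsMinCover w C = IsCover w C × (∀ C' → IsCover w C' → weight C ≤ weight C')

IsMaxWeight : ∀ {m n} → Weight m n → ℕ → Set
IsMaxWeight w N = (∃ λ x → ∃ λ y → w x y ≡ N) × (∀ x y → w x y ≤ N)

-- uv is an edge of G_h iff w(u,v) ∈ [N-h+1, N], i.e. N ∸ h < w u v
-- (assuming h ≤ N and N is the maximum weight).
InGh : ℕ → ℕ → ℕ → Set
InGh N h k = N ∸ h < k

-- Weights of G_h on all pairs: w(u,v) - (N-h) on edges of G_h, 0 otherwise.
-- (w ∸ (N ∸ h) is exactly this: it is 0 precisely when w ≤ N - h.)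
weightGh : ∀ {m n} → Weight m n → ℕ → ℕ → Weight m n
weightGh w N h x y = w x y ∸ (N ∸ h)

NodeXGh : ∀ {m n} → Weight m n → ℕ → ℕ → Fin m → Set
NodeXGh w N h x = ∃ λ y → InGh N h (w x y)

NodeYGh : ∀ {m n} → Weight m n → ℕ → ℕ → Fin n → Set
NodeYGh w N h y = ∃ λ x → InGh N h (w x y)

-- Labelings vanishing on the nodes of G outside G_h
-- (= covers of G_h extended by 0).
ZeroOffGh : ∀ {m n} → Weight m n → ℕ → ℕ → Labeling m n → Set
ZeroOffGh w N h C =
  (∀ x → ¬ (NodeXGh w N h x) → onX C x ≡ 0) × (∀ y → ¬ (NodeYGh w N h y) → onY C y ≡ 0)

IsMinCoverGh : ∀ {m n} → Weight m n → ℕ → ℕ → Labeling m n → Set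
IsMinCoverGh w N h C =
  ZeroOffGh w N h C × IsCover (weightGh w N h) C ×
  (∀ C' → ZeroOffGh w N h C' → IsCover (weightGh w N h) C' → weight C ≤ weight C')

{-# OPTIONS --safe #-}
-- Minimum covers can be uncrossed: for covers C, D of w, the labelings C ∧ D (⊓ on X, ⊔ on Y)
-- and C ∨ D (⊔ on X, ⊓ on Y) are again covers, and together they weigh as much as C and D.
-- Let D be a minimum cover of G and t = N ∸ h.  Since w ≤ t + (w ∸ t), lifting Ch by t on X
-- gives a cover Ch ↑ˣ t of G.  Lowering D ∨ (Ch ↑ˣ t) by t on X gives a cover of w ∸ t, the
-- weights of G_h, so it weighs at least Ch (a cover of w ∸ t restricted to the nodes of G_h
-- is still one); hence D ∧ (Ch ↑ˣ t) weighs at most D, is a minimum cover of G, and dominates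
-- Ch on Y.  The same step with X and Y exchanged then dominates Ch on X while staying above
-- Ch on Y.
module Submission where

open import Defs
open import Data.Bool using (if_then_else_)
open import Data.Fin using (Fin; toℕ; fromℕ<)
open import Data.Fin.Properties using (any?; all?; toℕ-fromℕ<)
open import Data.List using ([]; _∷_; map; allFin)
open import Data.Nat using (ℕ; zero; suc; _+_; _∸_; _⊓_; _⊔_; _≤_; _<_; z≤n; s≤s; _≤?_; _<?_)
open import Data.Nat.Induction using (<-wellFounded)
open import Data.Nat.ListAction using (sum)
open import Data.Nat.Properties
open import Algebra.Properties.CommutativeSemigroup +-commutativeSemigroup using (interchange)
open import Data.Product using (_×_; _,_; ∃)
open import Data.Sum using (_⊎_; inj₁; inj₂; [_,_])
open import Data.Vec using (Vec; []; _∷_; lookup; tabulate)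
open import Data.Vec.Properties using (lookup∘tabulate)
open import Function using (_∘_; const)
open import Induction.WellFounded using (Acc; acc)
open import Relation.Binary.PropositionalEquality using (_≡_; refl; sym; trans; cong; cong₂; subst; module ≡-Reasoning)
open import Relation.Nullary using (Dec; yes; no; does; ¬_; contradiction)
open import Relation.Nullary.Decidable using (map′; _×-dec_)
open import Relation.Unary using (Decidable)

private
  variable
    m n : ℕ

⊓-+-⊔ : ∀ a b → a ⊓ b + (a ⊔ b) ≡ a + b
⊓-+-⊔ a b with ≤-total a b
... | inj₁ a≤b = cong₂ _+_ (m≤n⇒m⊓n≡m a≤b) (m≤n⇒m⊔n≡n a≤b)
... | inj₂ b≤a = trans (cong₂ _+_ (m≥n⇒m⊓n≡n b≤a) (m≥n⇒m⊔n≡m b≤a)) (+-comm b a)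

≤-⊓-+-⊔ : ∀ a b a′ b′ {v} → v ≤ a + b → v ≤ a′ + b′ → v ≤ a ⊓ a′ + (b ⊔ b′)
≤-⊓-+-⊔ a b a′ b′ {v} v≤ v≤′ = begin
  v                                  ≤⟨ ⊓-glb v≤ v≤′ ⟩
  (a + b) ⊓ (a′ + b′)                ≤⟨ ⊓-mono-≤ (+-monoʳ-≤ a (m≤m⊔n b b′)) (+-monoʳ-≤ a′ (m≤n⊔m b b′)) ⟩
  (a + (b ⊔ b′)) ⊓ (a′ + (b ⊔ b′))   ≡⟨ +-distribʳ-⊓ (b ⊔ b′) a a′ ⟨
  a ⊓ a′ + (b ⊔ b′)                  ∎
  where open ≤-Reasoning

≤-⊔-+-⊓ : ∀ a b a′ b′ {v} → v ≤ a + b → v ≤ a′ + b′ → v ≤ a ⊔ a′ + (b ⊓ b′)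
≤-⊔-+-⊓ a b a′ b′ {v} v≤ v≤′ = subst (v ≤_) (+-comm (b ⊓ b′) (a ⊔ a′))
  (≤-⊓-+-⊔ b a b′ a′ (subst (v ≤_) (+-comm a b) v≤) (subst (v ≤_) (+-comm a′ b′) v≤′))

⊓-+-⊔-∸ : ∀ a b t → a ⊓ (t + b) + (a ⊔ (t + b) ∸ t) ≡ a + b
⊓-+-⊔-∸ a b t = begin
  a ⊓ (t + b) + (a ⊔ (t + b) ∸ t)   ≡⟨ +-∸-assoc (a ⊓ (t + b)) (≤-trans (m≤m+n t b) (m≤n⊔m a (t + b))) ⟨
  a ⊓ (t + b) + (a ⊔ (t + b)) ∸ t   ≡⟨ cong (_∸ t) (⊓-+-⊔ a (t + b)) ⟩
  a + (t + b) ∸ t                   ≡⟨ +-∸-assoc a (m≤m+n t b) ⟩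
  a + (t + b ∸ t)                   ≡⟨ cong (a +_) (m+n∸m≡n t b) ⟩
  a + b                             ∎
  where open ≡-Reasoning

≤-⊓-+-⊓ : ∀ a b c {v} → v ≤ a + b → v ≤ c → v ≤ a ⊓ c + b ⊓ c
≤-⊓-+-⊓ a b c v≤a+b v≤c with ≤-total a c | ≤-total b c
... | inj₂ c≤a | _        rewrite m≥n⇒m⊓n≡n c≤a = ≤-trans v≤c (m≤m+n c (b ⊓ c))
... | inj₁ a≤c | inj₂ c≤b rewrite m≥n⇒m⊓n≡n c≤b = ≤-trans v≤c (m≤n+m c (a ⊓ c))
... | inj₁ a≤c | inj₁ b≤c rewrite m≤n⇒m⊓n≡m a≤c | m≤n⇒m⊓n≡m b≤c = v≤a+b

sum-map-+ : ∀ {A : Set} (f g : A → ℕ) xs →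
  sum (map (λ i → f i + g i) xs) ≡ sum (map f xs) + sum (map g xs)
sum-map-+ f g []       = refl
sum-map-+ f g (x ∷ xs) = trans (cong (f x + g x +_) (sum-map-+ f g xs))
  (interchange (f x) (g x) (sum (map f xs)) (sum (map g xs)))

sum-map-mono : ∀ {A : Set} {f g : A → ℕ} → (∀ i → f i ≤ g i) → ∀ xs →
  sum (map f xs) ≤ sum (map g xs)
sum-map-mono f≤g []       = z≤n
sum-map-mono f≤g (x ∷ xs) = +-mono-≤ (f≤g x) (sum-map-mono f≤g xs)

infix  4 _≤ᴸ_
infixl 6 _⊕_

_≤ᴸ_ : Labeling m n → Labeling m n → Set
C ≤ᴸ D = (∀ x → onX C x ≤ onX D x) × (∀ y → onY C y ≤ onY D y)

_⊕_ : Labeling m n → Labeling m n → Labeling m n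
C ⊕ D = ⟨ (λ x → onX C x + onX D x) , (λ y → onY C y + onY D y) ⟩

_∧_ : Labeling m n → Labeling m n → Labeling m n
C ∧ D = ⟨ (λ x → onX C x ⊓ onX D x) , (λ y → onY C y ⊔ onY D y) ⟩

_∨_ : Labeling m n → Labeling m n → Labeling m n
C ∨ D = ⟨ (λ x → onX C x ⊔ onX D x) , (λ y → onY C y ⊓ onY D y) ⟩

_↑ˣ_ : Labeling m n → ℕ → Labeling m n
C ↑ˣ t = ⟨ (λ x → t + onX C x) , onY C ⟩

_↑ʸ_ : Labeling m n → ℕ → Labeling m n
C ↑ʸ t = ⟨ onX C , (λ y → t + onY C y) ⟩

_↓ˣ_ : Labeling m n → ℕ → Labeling m n
C ↓ˣ t = ⟨ (λ x → onX C x ∸ t) , onY C ⟩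

_∸ʷ_ : Weight m n → ℕ → Weight m n
(w ∸ʷ t) x y = w x y ∸ t

transpose : Weight m n → Weight n m
transpose w y x = w x y

swap : Labeling m n → Labeling n m
swap C = ⟨ onY C , onX C ⟩

weight-mono : {C D : Labeling m n} → C ≤ᴸ D → weight C ≤ weight D
weight-mono {m} {n} (≤ˣ , ≤ʸ) =
  +-mono-≤ (sum-map-mono ≤ˣ (allFin m)) (sum-map-mono ≤ʸ (allFin n))

weight-⊕ : (C D : Labeling m n) → weight (C ⊕ D) ≡ weight C + weight D
weight-⊕ {m} {n} C D = trans
  (cong₂ _+_ (sum-map-+ (onX C) (onX D) (allFin m)) (sum-map-+ (onY C) (onY D) (allFin n)))
  (interchange (sum (map (onX C) (allFin m))) (sum (map (onX D) (allFin m)))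
               (sum (map (onY C) (allFin n))) (sum (map (onY D) (allFin n))))

weight-swap : (C : Labeling m n) → weight (swap C) ≡ weight C
weight-swap {m} {n} C = +-comm (sum (map (onY C) (allFin n))) (sum (map (onX C) (allFin m)))

swap-cover : {w : Weight m n} (C : Labeling m n) → IsCover w C → IsCover (transpose w) (swap C)
swap-cover {w = w} C cover y x = subst (w x y ≤_) (+-comm (onX C x) (onY C y)) (cover x y)

swap-minCover : {w : Weight m n} {C : Labeling m n} → IsMinCover w C → IsMinCover (transpose w) (swap C)
swap-minCover {C = C} (cover , minimal) = swap-cover C cover , λ C′ C′-cover → begin
  weight (swap C)   ≡⟨ weight-swap C ⟩
  weight C          ≤⟨ minimal (swap C′) (swap-cover C′ C′-cover) ⟩
  weight (swap C′)  ≡⟨ weight-swap C′ ⟩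
  weight C′         ∎
  where open ≤-Reasoning

∧-cover : {w : Weight m n} (C D : Labeling m n) → IsCover w C → IsCover w D → IsCover w (C ∧ D)
∧-cover C D C-cover D-cover x y =
  ≤-⊓-+-⊔ (onX C x) (onY C y) (onX D x) (onY D y) (C-cover x y) (D-cover x y)

∨-cover : {w : Weight m n} (C D : Labeling m n) → IsCover w C → IsCover w D → IsCover w (C ∨ D)
∨-cover C D C-cover D-cover x y =
  ≤-⊔-+-⊓ (onX C x) (onY C y) (onX D x) (onY D y) (C-cover x y) (D-cover x y)

module _ {w : Weight m n} (t : ℕ) (C : Labeling m n) where

  ↑ˣ-cover : IsCover (w ∸ʷ t) C → IsCover w (C ↑ˣ t)
  ↑ˣ-cover cover x y = begin
    w x y                        ≤⟨ m≤n+m∸n (w x y) t ⟩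
    t + (w x y ∸ t)              ≤⟨ +-monoʳ-≤ t (cover x y) ⟩
    t + (onX C x + onY C y)      ≡⟨ +-assoc t (onX C x) (onY C y) ⟨
    t + onX C x + onY C y        ∎
    where open ≤-Reasoning

  ↓ˣ-cover : IsCover w C → IsCover (w ∸ʷ t) (C ↓ˣ t)
  ↓ˣ-cover cover x y = m≤n+o⇒m∸n≤o (w x y) t (begin
    w x y                          ≤⟨ cover x y ⟩
    onX C x + onY C y              ≤⟨ +-monoˡ-≤ (onY C y) (m≤n+m∸n (onX C x) t) ⟩
    t + (onX C x ∸ t) + onY C y    ≡⟨ +-assoc t (onX C x ∸ t) (onY C y) ⟩
    t + (onX C x ∸ t + onY C y)    ∎)
    where open ≤-Reasoning

minCover-exchange : {w w′ : Weight m n} {D E L R : Labeling m n} →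
  IsMinCover w D → IsMinCover w′ E → IsCover w L → IsCover w′ R →
  L ⊕ R ≤ᴸ D ⊕ E → IsMinCover w L
minCover-exchange {D = D} {E} {L} {R} (_ , D-minimal) (_ , E-minimal) L-cover R-cover L⊕R≤D⊕E =
  L-cover , λ C C-cover → ≤-trans L≤D (D-minimal C C-cover)
  where
  open ≤-Reasoning
  L≤D : weight L ≤ weight D
  L≤D = +-cancelʳ-≤ (weight R) (weight L) (weight D) (begin
    weight L + weight R   ≡⟨ weight-⊕ L R ⟨
    weight (L ⊕ R)        ≤⟨ weight-mono L⊕R≤D⊕E ⟩
    weight (D ⊕ E)        ≡⟨ weight-⊕ D E ⟩
    weight D + weight E   ≤⟨ +-monoʳ-≤ (weight D) (E-minimal R R-cover) ⟩
    weight D + weight R   ∎)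

module _ {w : Weight m n} {t : ℕ} {D E : Labeling m n} where

  ∧-↑ˣ-minCover : IsMinCover w D → IsMinCover (w ∸ʷ t) E → IsMinCover w (D ∧ (E ↑ˣ t))
  ∧-↑ˣ-minCover D-min@(D-cover , _) E-min@(E-cover , _) =
    minCover-exchange D-min E-min (∧-cover D (E ↑ˣ t) D-cover E↑-cover)
      (↓ˣ-cover t (D ∨ (E ↑ˣ t)) (∨-cover D (E ↑ˣ t) D-cover E↑-cover))
      ((λ x → ≤-reflexive (⊓-+-⊔-∸ (onX D x) (onX E x) t)) ,
       (λ y → ≤-reflexive (trans (+-comm (onY D y ⊔ onY E y) _) (⊓-+-⊔ (onY D y) (onY E y)))))
    where
    E↑-cover : IsCover w (E ↑ˣ t)
    E↑-cover = ↑ˣ-cover t E E-cover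

∨-↑ʸ-minCover : {w : Weight m n} {t : ℕ} {D E : Labeling m n} →
  IsMinCover w D → IsMinCover (w ∸ʷ t) E → IsMinCover w (D ∨ (E ↑ʸ t))
∨-↑ʸ-minCover D-min E-min = swap-minCover (∧-↑ˣ-minCover (swap-minCover D-min) (swap-minCover E-min))

module _ {P : Fin m → Set} {Q : Fin n → Set} (P? : Decidable P) (Q? : Decidable Q) where

  restrict : Labeling m n → Labeling m n
  restrict C = ⟨ (λ x → if does (P? x) then onX C x else 0) , (λ y → if does (Q? y) then onY C y else 0) ⟩

  restrict-≤ : (C : Labeling m n) → restrict C ≤ᴸ C
  restrict-≤ C = ≤ˣ , ≤ʸ
    where
    ≤ˣ : ∀ x → onX (restrict C) x ≤ onX C x
    ≤ˣ x with P? x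
    ... | yes _ = ≤-refl
    ... | no _  = z≤n
    ≤ʸ : ∀ y → onY (restrict C) y ≤ onY C y
    ≤ʸ y with Q? y
    ... | yes _ = ≤-refl
    ... | no _  = z≤n

  restrict-vanishes : (C : Labeling m n) →
    (∀ x → ¬ P x → onX (restrict C) x ≡ 0) × (∀ y → ¬ Q y → onY (restrict C) y ≡ 0)
  restrict-vanishes C = vanishesˣ , vanishesʸ
    where
    vanishesˣ : ∀ x → ¬ P x → onX (restrict C) x ≡ 0
    vanishesˣ x ¬p with P? x
    ... | yes p = contradiction p ¬p
    ... | no _  = refl
    vanishesʸ : ∀ y → ¬ Q y → onY (restrict C) y ≡ 0
    vanishesʸ y ¬q with Q? y
    ... | yes q = contradiction q ¬q
    ... | no _  = refl

  restrict-cover : {w : Weight m n} → (∀ x y → ¬ P x ⊎ ¬ Q y → w x y ≡ 0) →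
    {C : Labeling m n} → IsCover w C → IsCover w (restrict C)
  restrict-cover outside cover x y with P? x | Q? y
  ... | yes _ | yes _ = cover x y
  ... | no ¬p | _     = ≤-trans (≤-reflexive (outside x y (inj₁ ¬p))) z≤n
  ... | yes _ | no ¬q = ≤-trans (≤-reflexive (outside x y (inj₂ ¬q))) z≤n

module _ {w : Weight m n} {N h : ℕ} where

  nodeXGh? : Decidable (NodeXGh w N h)
  nodeXGh? x = any? λ y → N ∸ h <? w x y

  nodeYGh? : Decidable (NodeYGh w N h)
  nodeYGh? y = any? λ x → N ∸ h <? w x y

  weightGh-outside : ∀ x y → ¬ NodeXGh w N h x ⊎ ¬ NodeYGh w N h y → weightGh w N h x y ≡ 0
  weightGh-outside x y outside =
    m≤n⇒m∸n≡0 (≮⇒≥ λ inGh → [ (λ ¬x → ¬x (y , inGh)) , (λ ¬y → ¬y (x , inGh)) ] outside)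

  IsMinCoverGh⇒IsMinCover : {C : Labeling m n} → IsMinCoverGh w N h C → IsMinCover (weightGh w N h) C
  IsMinCoverGh⇒IsMinCover (_ , cover , minimal) = cover , λ C′ C′-cover → ≤-trans
    (minimal (restrict nodeXGh? nodeYGh? C′) (restrict-vanishes nodeXGh? nodeYGh? C′)
      (restrict-cover nodeXGh? nodeYGh? weightGh-outside C′-cover))
    (weight-mono (restrict-≤ nodeXGh? nodeYGh? C′))

anyVec? : ∀ {b} k {P : Vec (Fin b) k → Set} → (∀ v → Dec (P v)) → Dec (∃ P)
anyVec? zero    P? = map′ ([] ,_) (λ { ([] , p) → p }) (P? [])
anyVec? (suc k) P? = map′ (λ (a , v , p) → a ∷ v , p) (λ { (a ∷ v , p) → a , v , p })
  (any? λ a → anyVec? k λ v → P? (a ∷ v))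

cover? : (w : Weight m n) → Decidable (IsCover w)
cover? w C = all? λ x → all? λ y → w x y ≤? onX C x + onY C y

module _ {w : Weight m n} {B : ℕ} (w≤B : ∀ x y → w x y ≤ B) where

  fromVecs : Vec (Fin (suc B)) m → Vec (Fin (suc B)) n → Labeling m n
  fromVecs u v = ⟨ toℕ ∘ lookup u , toℕ ∘ lookup v ⟩

  capVec : ∀ {k} → (Fin k → ℕ) → Vec (Fin (suc B)) k
  capVec f = tabulate λ i → fromℕ< (s≤s (m⊓n≤n (f i) B))

  capVec-lookup : ∀ {k} (f : Fin k → ℕ) i → toℕ (lookup (capVec f) i) ≡ f i ⊓ B
  capVec-lookup f i = trans (cong toℕ (lookup∘tabulate _ i)) (toℕ-fromℕ< _)

  cap : Labeling m n → Labeling m n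
  cap C = fromVecs (capVec (onX C)) (capVec (onY C))

  cap-≤ : (C : Labeling m n) → cap C ≤ᴸ C
  cap-≤ C = (λ x → ≤-trans (≤-reflexive (capVec-lookup (onX C) x)) (m⊓n≤m (onX C x) B))
          , (λ y → ≤-trans (≤-reflexive (capVec-lookup (onY C) y)) (m⊓n≤m (onY C y) B))

  cap-cover : (C : Labeling m n) → IsCover w C → IsCover w (cap C)
  cap-cover C cover x y =
    subst (w x y ≤_) (sym (cong₂ _+_ (capVec-lookup (onX C) x) (capVec-lookup (onY C) y)))
      (≤-⊓-+-⊓ (onX C x) (onY C y) B (cover x y) (w≤B x y))

  -- Capping at B keeps covers covers, so a cheaper cover exists iff one with values ≤ B does.
  cheaperCover? : ∀ k → Dec (∃ λ u → ∃ λ v → IsCover w (fromVecs u v) × weight (fromVecs u v) < k)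
  cheaperCover? k = anyVec? m λ u → anyVec? n λ v → cover? w (fromVecs u v) ×-dec weight (fromVecs u v) <? k

  minCover-from : (C : Labeling m n) → IsCover w C → Acc _<_ (weight C) → ∃ (IsMinCover w)
  minCover-from C cover (acc below) with cheaperCover? (weight C)
  ... | yes (u , v , cover′ , cheaper) = minCover-from (fromVecs u v) cover′ (below cheaper)
  ... | no noCheaper = C , cover , λ C′ C′-cover → ≮⇒≥ λ C′-cheaper →
    noCheaper (capVec (onX C′) , capVec (onY C′) , cap-cover C′ C′-cover ,
               ≤-<-trans (weight-mono (cap-≤ C′)) C′-cheaper)

  minCover : ∃ (IsMinCover w)
  minCover = minCover-from ⟨ const 0 , const B ⟩ w≤B (<-wellFounded _)

lemma2p4 : ∀ {m n} (w : Weight m n) (N h : ℕ) →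
    IsMaxWeight w N → 1 ≤ h → h ≤ N →
    (Ch : Labeling m n) → IsMinCoverGh w N h Ch →
    ∃ λ (C : Labeling m n) → IsMinCover w C ×
      (∀ x → onX Ch x ≤ onX C x) × (∀ y → onY Ch y ≤ onY C y)
lemma2p4 w N h (_ , w≤N) _ _ Ch Ch-minGh with minCover w≤N
... | D , D-min = D₂ , D₂-min , Ch≤D₂
  where
  t : ℕ
  t = N ∸ h
  Ch-min : IsMinCover (w ∸ʷ t) Ch
  Ch-min = IsMinCoverGh⇒IsMinCover {N = N} {h} Ch-minGh
  D₁ D₂ : Labeling _ _
  D₁ = D ∧ (Ch ↑ˣ t)
  D₂ = D₁ ∨ (Ch ↑ʸ t)
  D₂-min : IsMinCover w D₂
  D₂-min = ∨-↑ʸ-minCover (∧-↑ˣ-minCover D-min Ch-min) Ch-min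
  Ch≤D₂ : Ch ≤ᴸ D₂
  Ch≤D₂ = (λ x → m≤n⊔m (onX D₁ x) (onX Ch x))
        , (λ y → ⊓-glb (m≤n⊔m (onY D y) (onY Ch y)) (m≤n+m (onY Ch y) t))
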